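{- Let $p=2^{2^k}+1$ be a Fermat prime, where $k\ge 0$ is an integer. Then \[ L(p^2)=\frac{1}{2^{2^k-k-1}}(p-1)=2^{k+1}. \]
   Context: For an integer $m\ge 2$, a cycle modulo $m$ of length $k\ge 1$ is a sequence $x_1,\dots,x_k$ of pairwise distinct residues modulo $m$ such that $x_i^2\equiv x_{i+1}\pmod m$ for $1\le i\le k-1$ and $x_k^2\equiv x_1\pmod m$. $L(m)$ denotes the maximum length of a cycle modulo $m$. -}

module Defs where

open import Data.Nat using (ℕ; zero; suc; _+_; _*_; _^_; _∸_; _<_; _≤_; _%_; NonZero)
open import Data.Fin using (Fin; toℕ; fromℕ; inject₁) renaming (zero to fzero; suc to fsuc)
open import Data.Product using (_×_)
open import Function.Definitions using (Injective)
open import Relation.Binary.PropositionalEquality using (_≡_)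

-- A residue modulo m is represented by its canonical representative in
-- {0,...,m-1}, i.e. an element of Fin m.  x^2 ≡ y (mod m) for residues x y
-- means (toℕ x * toℕ x) % m ≡ toℕ y.
SqStep : (m : ℕ) .{{_ : NonZero m}} → Fin m → Fin m → Set
SqStep m x y = (toℕ x * toℕ x) % m ≡ toℕ y

record IsCycle (m : ℕ) .{{_ : NonZero m}} (n : ℕ) (x : Fin (suc n) → Fin m) : Set where
  field
    distinct : Injective _≡_ _≡_ x
    step     : ∀ (i : Fin n) → SqStep m (x (inject₁ i)) (x (fsuc i))
    wrap     : SqStep m (x (fromℕ n)) (x fzero)

IsMaxCycleLength : (m : ℕ) .{{_ : NonZero m}} → ℕ → Set
IsMaxCycleLength m ℓ =
  (Σ-cycle ℓ) × (∀ n (x : Fin (suc n) → Fin m) → IsCycle m n x → suc n ≤ ℓ)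
  where
  open import Data.Product using (Σ; ∃)
  Σ-cycle : ℕ → Set
  Σ-cycle ℓ = ∃ λ n → (suc n ≡ ℓ) × ∃ λ (x : Fin (suc n) → Fin m) → IsCycle m n x

module Submission where

-- Modulo p², squaring sends 1 + p·w to 1 + p·2w, so the residues
-- 1 + p·2^j (0 ≤ j < 2E) form a cycle: 2^(2E) ≡ 1 (mod p) because
-- 2^E ≡ -1, and the powers 2^j (j < 2E) are distinct modulo p.
--
-- Every element a of a cycle satisfies a ≡ a^(2^L) (mod p²)
-- for some L ≥ 1.  If p ∣ a this forces a = 0.  Otherwise Fermat's little
-- theorem lifted to p² gives a^((p-1)p) ≡ 1, and since 2^E = p - 1 divides
-- 2^(EL) the congruence a ≡ a^(2^(EL)) yields a^p ≡ 1 (mod p²).  As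
-- 2^(2E) = (p-1)² ≡ 1 (mod p) we get a^(2^(2E)) ≡ a, so a cycle longer than
-- 2E would revisit its first element after 2E steps.

open import Defs
open import Data.Nat.Primality using (Prime; euclidsLemma; prime⇒nonTrivial)
open import Data.Product using (∃; _,_; proj₁; proj₂; _×_)

open import Data.Nat
open import Data.Nat.Properties
open import Data.Nat.DivMod
open import Data.Nat.Divisibility
open import Data.Nat.Combinatorics using (_C_; nCk+nC[k+1]≡[n+1]C[k+1]; nC1≡n; nCn≡1)
open import Data.Nat.Tactic.RingSolver using (solve-∀)
open import Data.Fin using (Fin; toℕ; fromℕ; inject₁; fromℕ<) renaming (zero to fzero; suc to fsuc)
open import Data.Fin.Properties using (toℕ-fromℕ; toℕ-inject₁; toℕ<n; toℕ-fromℕ<; toℕ-injective)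
open import Data.Sum using (_⊎_; inj₁; inj₂)
open import Data.Empty using (⊥-elim)
open import Relation.Nullary using (¬_; yes; no)
open import Relation.Binary.PropositionalEquality
open import Relation.Binary.Definitions using (tri<; tri≈; tri>)
open import Function using (_∘_)
open import Algebra.Properties.CommutativeSemigroup *-commutativeSemigroup using (xy∙z≈xz∙y)
import Algebra.Properties.CommutativeSemiring.Binomial +-*-commutativeSemiring as Binomial
import Algebra.Properties.Semiring.Mult +-*-semiring as Mult
import Algebra.Properties.Semiring.Exp +-*-semiring as Exp
import Algebra.Properties.Semiring.Sum +-*-semiring as Sum

absorption : ∀ n k → suc k * (suc n C suc k) ≡ suc n * (n C k)
absorption zero    zero    = refl
absorption zero    (suc k) = *-zeroʳ (suc (suc k))
absorption (suc n) zero    = begin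
  1 * (suc (suc n) C 1) ≡⟨ *-identityˡ _ ⟩
  suc (suc n) C 1       ≡⟨ nC1≡n (suc (suc n)) ⟩
  suc (suc n)           ≡⟨ sym (*-identityʳ _) ⟩
  suc (suc n) * 1       ∎
  where open ≡-Reasoning
absorption (suc n) (suc k) = begin
  (2 + k) * ((2 + n) C (2 + k))                  ≡⟨ cong ((2 + k) *_) (sym (nCk+nC[k+1]≡[n+1]C[k+1] (suc n) (suc k))) ⟩
  (2 + k) * (A + B)                              ≡⟨ regroup k A B ⟩
  (1 + k) * A + A + (2 + k) * B                  ≡⟨ cong₂ (λ u v → u + A + v) (absorption n k) (absorption n (suc k)) ⟩
  (1 + n) * (n C k) + A + (1 + n) * (n C suc k) ≡⟨ collect n (n C k) (n C suc k) A ⟩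
  (1 + n) * (n C k + n C suc k) + A              ≡⟨ cong (λ u → (1 + n) * u + A) (nCk+nC[k+1]≡[n+1]C[k+1] n k) ⟩
  (1 + n) * A + A                                ≡⟨ add-one n A ⟩
  (2 + n) * A                                    ∎
  where
  open ≡-Reasoning
  A = suc n C suc k
  B = suc n C suc (suc k)
  regroup : ∀ k A B → (2 + k) * (A + B) ≡ (1 + k) * A + A + (2 + k) * B
  regroup = solve-∀
  collect : ∀ n x y A → (1 + n) * x + A + (1 + n) * y ≡ (1 + n) * (x + y) + A
  collect = solve-∀
  add-one : ∀ n A → (1 + n) * A + A ≡ (2 + n) * A
  add-one = solve-∀

-- A prime p divides C(p,i) for 0 < i < p: it divides i·C(p,i) = p·C(p-1,i-1)
-- but not i.
prime∣binomial : ∀ {p} → Prime p → ∀ i → 0 < i → i < p → p ∣ p C i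
prime∣binomial {suc n} prime-p (suc k) _ i<p
  with euclidsLemma (suc k) (suc n C suc k) prime-p
         (divides (n C k) (trans (absorption n k) (*-comm (suc n) (n C k))))
... | inj₁ p∣i     = ⊥-elim (<⇒≱ i<p (∣⇒≤ p∣i))
... | inj₂ p∣binom = p∣binom

×≡* : ∀ n x → n Mult.× x ≡ n * x
×≡* zero    x = refl
×≡* (suc n) x = cong (x +_) (×≡* n x)

^≡^ : ∀ x n → x Exp.^ n ≡ x ^ n
^≡^ x zero    = refl
^≡^ x (suc n) = cong (x *_) (^≡^ x n)

∣-sum : ∀ d n (g : Fin n → ℕ) → (∀ i → d ∣ g i) → d ∣ Sum.sum g
∣-sum d zero    g d∣g = d ∣0
∣-sum d (suc n) g d∣g = ∣m∣n⇒∣m+n (d∣g fzero) (∣-sum d n (g ∘ fsuc) (d∣g ∘ fsuc))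

freshman : ∀ q a → Prime (suc q) →
  ∃ λ M → suc q ∣ M × (a + 1) ^ suc q ≡ 1 + (M + a ^ suc q)
freshman q a prime-p = M , p∣M , expansion
  where
  open ≡-Reasoning
  p = suc q
  term = Binomial.binomialTerm a 1 p
  binomial = Binomial.binomial a 1 p
  inner : Fin q → Fin (suc p)
  inner i = fsuc (inject₁ i)
  M = Sum.sum (term ∘ inner)

  p∣M : p ∣ M
  p∣M = ∣-sum p q (term ∘ inner) λ i →
    subst (p ∣_) (sym (×≡* (p C toℕ (inner i)) (binomial (inner i))))
      (∣m⇒∣m*n (binomial (inner i)) (prime∣binomial prime-p (toℕ (inner i)) z<s
        (s<s (subst (_< q) (sym (toℕ-inject₁ i)) (toℕ<n i)))))

  first : term fzero ≡ 1
  first = begin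
    term fzero                  ≡⟨ ×≡* (p C 0) (binomial fzero) ⟩
    1 * (1 * (1 Exp.^ p))       ≡⟨ cong (λ u → 1 * (1 * u)) (trans (^≡^ 1 p) (^-zeroˡ p)) ⟩
    1                           ∎

  last : term (fsuc (fromℕ q)) ≡ a ^ p
  last = begin
    term (fsuc (fromℕ q))
      ≡⟨ ×≡* (p C j) (binomial (fsuc (fromℕ q))) ⟩
    (p C j) * (a Exp.^ j * 1 Exp.^ (p ∸ j))
      ≡⟨ cong (λ j → (p C j) * (a Exp.^ j * 1 Exp.^ (p ∸ j))) (cong suc (toℕ-fromℕ q)) ⟩
    (p C p) * (a Exp.^ p * 1 Exp.^ (p ∸ p))
      ≡⟨ cong₂ (λ u v → u * (v * 1 Exp.^ (p ∸ p))) (nCn≡1 p) (^≡^ a p) ⟩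
    1 * (a ^ p * 1 Exp.^ (p ∸ p))
      ≡⟨ cong (λ j → 1 * (a ^ p * 1 Exp.^ j)) (n∸n≡0 p) ⟩
    1 * (a ^ p * 1)
      ≡⟨ trans (*-identityˡ _) (*-identityʳ _) ⟩
    a ^ p ∎
    where j = toℕ (fsuc (fromℕ q))

  expansion : (a + 1) ^ p ≡ 1 + (M + a ^ p)
  expansion = begin
    (a + 1) ^ p                        ≡⟨ sym (^≡^ (a + 1) p) ⟩
    (a + 1) Exp.^ p                    ≡⟨ Binomial.theorem p a 1 ⟩
    Sum.sum term                       ≡⟨ cong (term fzero +_) (Sum.sum-init-last (term ∘ fsuc)) ⟩
    term fzero + (M + term (fsuc (fromℕ q))) ≡⟨ cong₂ (λ u v → u + (M + v)) first last ⟩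
    1 + (M + a ^ p)                    ∎

%-cong-* : ∀ m .{{_ : NonZero m}} {a a′ b b′} →
           a % m ≡ a′ % m → b % m ≡ b′ % m → (a * b) % m ≡ (a′ * b′) % m
%-cong-* m {a} {a′} {b} {b′} a≡a′ b≡b′ = begin
  (a * b) % m                 ≡⟨ %-distribˡ-* a b m ⟩
  ((a % m) * (b % m)) % m     ≡⟨ cong₂ (λ u v → (u * v) % m) a≡a′ b≡b′ ⟩
  ((a′ % m) * (b′ % m)) % m   ≡⟨ sym (%-distribˡ-* a′ b′ m) ⟩
  (a′ * b′) % m               ∎
  where open ≡-Reasoning

%-cong-^ : ∀ m .{{_ : NonZero m}} {a b} → a % m ≡ b % m → ∀ e → (a ^ e) % m ≡ (b ^ e) % m
%-cong-^ m a≡b zero    = refl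
%-cong-^ m a≡b (suc e) = %-cong-* m a≡b (%-cong-^ m a≡b e)

%-^-one : ∀ m .{{_ : NonZero m}} → 1 < m → ∀ {a} → a % m ≡ 1 → ∀ e → (a ^ e) % m ≡ 1
%-^-one m 1<m {a} a≡1 e = begin
  (a ^ e) % m   ≡⟨ %-cong-^ m (trans a≡1 (sym (m<n⇒m%n≡m 1<m))) e ⟩
  (1 ^ e) % m   ≡⟨ cong (_% m) (^-zeroˡ e) ⟩
  1 % m         ≡⟨ m<n⇒m%n≡m 1<m ⟩
  1             ∎
  where open ≡-Reasoning

%≡⇒∣∸ : ∀ d .{{_ : NonZero d}} {u v} → u ≤ v → u % d ≡ v % d → d ∣ v ∸ u
%≡⇒∣∸ d {u} {v} u≤v u≡v = divides (v / d ∸ u / d) (begin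
  v ∸ u                                     ≡⟨ cong₂ _∸_ (m≡m%n+[m/n]*n v d) (m≡m%n+[m/n]*n u d) ⟩
  (v % d + v / d * d) ∸ (u % d + u / d * d) ≡⟨ cong (λ r → (v % d + v / d * d) ∸ (r + u / d * d)) u≡v ⟩
  (v % d + v / d * d) ∸ (v % d + u / d * d) ≡⟨ [m+n]∸[m+o]≡n∸o (v % d) (v / d * d) (u / d * d) ⟩
  v / d * d ∸ u / d * d                     ≡⟨ sym (*-distribʳ-∸ d (v / d) (u / d)) ⟩
  (v / d ∸ u / d) * d                       ∎)
  where open ≡-Reasoning

∣∸⇒%≡ : ∀ d .{{_ : NonZero d}} {u v} → u ≤ v → d ∣ v ∸ u → u % d ≡ v % d
∣∸⇒%≡ d {u} {v} u≤v d∣v∸u = begin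
  u % d               ≡⟨ sym (%-remove-+ʳ u d∣v∸u) ⟩
  (u + (v ∸ u)) % d   ≡⟨ cong (_% d) (m+[n∸m]≡n u≤v) ⟩
  v % d               ∎
  where open ≡-Reasoning

∣*∸⇒∣∸ : ∀ {p} .{{_ : NonZero p}} → Prime p → ∀ {a} → ¬ (p ∣ a) →
         ∀ {u v} → u ≤ v → (a * u) % p ≡ (a * v) % p → p ∣ v ∸ u
∣*∸⇒∣∸ {p} prime-p {a} p∤a {u} {v} u≤v au≡av
  with euclidsLemma a (v ∸ u) prime-p
         (subst (p ∣_) (sym (*-distribˡ-∸ a v u)) (%≡⇒∣∸ p (*-monoʳ-≤ a u≤v) au≡av))
... | inj₁ p∣a   = ⊥-elim (p∤a p∣a)
... | inj₂ p∣v∸u = p∣v∸u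

%-cancel-* : ∀ {p} .{{_ : NonZero p}} → Prime p → ∀ {a} → ¬ (p ∣ a) →
             ∀ x y → (a * x) % p ≡ (a * y) % p → x % p ≡ y % p
%-cancel-* {p} prime-p p∤a x y ax≡ay with ≤-total x y
... | inj₁ x≤y = ∣∸⇒%≡ p x≤y (∣*∸⇒∣∸ prime-p p∤a x≤y ax≡ay)
... | inj₂ y≤x = sym (∣∸⇒%≡ p y≤x (∣*∸⇒∣∸ prime-p p∤a y≤x (sym ax≡ay)))

-- Fermat's little theorem, by induction on a using the freshman's dream.
fermat : ∀ q → Prime (suc q) → ∀ a → (a ^ suc q) % suc q ≡ a % suc q
fermat q prime-p zero    = refl
fermat q prime-p (suc a) with freshman q a prime-p
... | M , p∣M , expansion = begin
  (suc a ^ p) % p                 ≡⟨ cong (λ z → (z ^ p) % p) (+-comm 1 a) ⟩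
  ((a + 1) ^ p) % p               ≡⟨ cong (_% p) expansion ⟩
  (1 + (M + a ^ p)) % p           ≡⟨ cong (_% p) (swap 1 M (a ^ p)) ⟩
  (M + (1 + a ^ p)) % p           ≡⟨ %-remove-+ˡ (1 + a ^ p) p∣M ⟩
  (1 + a ^ p) % p                 ≡⟨ %-distribˡ-+ 1 (a ^ p) p ⟩
  (1 % p + (a ^ p) % p) % p       ≡⟨ cong (λ z → (1 % p + z) % p) (fermat q prime-p a) ⟩
  (1 % p + a % p) % p             ≡⟨ sym (%-distribˡ-+ 1 a p) ⟩
  suc a % p                       ∎
  where
  open ≡-Reasoning
  p = suc q
  swap : ∀ x y z → x + (y + z) ≡ y + (x + z)
  swap = solve-∀

fermat-unit : ∀ q → Prime (suc q) → ∀ a → ¬ (suc q ∣ a) → (a ^ q) % suc q ≡ 1 % suc q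
fermat-unit q prime-p a p∤a =
  %-cancel-* prime-p p∤a (a ^ q) 1 (trans (fermat q prime-p a) (cong (_% suc q) (sym (*-identityʳ a))))

prime⇒1< : ∀ {p} → Prime p → 1 < p
prime⇒1< {p} prime-p = nonTrivial⇒n>1 p {{prime⇒nonTrivial prime-p}}

binomial-lift : ∀ p t n → ∃ λ s → (1 + t * p) ^ n ≡ 1 + n * t * p + s * (p * p)
binomial-lift p t zero    = 0 , refl
binomial-lift p t (suc n) with binomial-lift p t n
... | s , expansion = s + n * t * t + t * s * p , trans (cong ((1 + t * p) *_) expansion) (multiply p t n s)
  where
  multiply : ∀ p t n s → (1 + t * p) * (1 + n * t * p + s * (p * p)) ≡
                         1 + (1 + n) * t * p + (s + n * t * t + t * s * p) * (p * p)
  multiply = solve-∀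

-- Euler's theorem for p²: a^((p-1)·p) ≡ 1 (mod p²) when p ∤ a.  Write
-- a^(p-1) = 1 + t·p by Fermat and raise it to the p-th power.
fermat-lift : ∀ q → Prime (suc q) → ∀ a → ¬ (suc q ∣ a) → (a ^ (q * suc q)) % (suc q * suc q) ≡ 1
fermat-lift q prime-p a p∤a = begin
  (a ^ (q * p)) % m                    ≡⟨ cong (_% m) (sym (^-*-assoc a q p)) ⟩
  ((a ^ q) ^ p) % m                    ≡⟨ cong (λ z → (z ^ p) % m) a^q≡1+tp ⟩
  ((1 + t * p) ^ p) % m                ≡⟨ cong (_% m) (proj₂ (binomial-lift p t p)) ⟩
  (1 + p * t * p + s * m) % m          ≡⟨ cong (_% m) (regroup p t s) ⟩
  (1 + (t + s) * m) % m                ≡⟨ [m+kn]%n≡m%n 1 (t + s) m ⟩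
  1 % m                                ≡⟨ m<n⇒m%n≡m (≤-trans (prime⇒1< prime-p) (m≤m*n p p)) ⟩
  1                                    ∎
  where
  open ≡-Reasoning
  p = suc q
  m = p * p
  t = (a ^ q) / p
  s = proj₁ (binomial-lift p t p)
  a^q≡1+tp : a ^ q ≡ 1 + t * p
  a^q≡1+tp = begin
    a ^ q                    ≡⟨ m≡m%n+[m/n]*n (a ^ q) p ⟩
    (a ^ q) % p + t * p      ≡⟨ cong (_+ t * p) (fermat-unit q prime-p a p∤a) ⟩
    1 % p + t * p            ≡⟨ cong (_+ t * p) (m<n⇒m%n≡m (prime⇒1< prime-p)) ⟩
    1 + t * p                ∎
  regroup : ∀ p t s → 1 + p * t * p + s * (p * p) ≡ 1 + (t + s) * (p * p)
  regroup = solve-∀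

square : ∀ m .{{_ : NonZero m}} → ℕ → ℕ
square m a = (a * a) % m

squarings : ∀ m .{{_ : NonZero m}} → ℕ → ℕ → ℕ
squarings m zero    a = a
squarings m (suc t) a = square m (squarings m t a)

squarings-%-pow : ∀ m .{{_ : NonZero m}} t a → squarings m t a % m ≡ (a ^ (2 ^ t)) % m
squarings-%-pow m zero    a = cong (_% m) (sym (*-identityʳ a))
squarings-%-pow m (suc t) a = begin
  ((b * b) % m) % m               ≡⟨ m%n%n≡m%n (b * b) m ⟩
  (b * b) % m                     ≡⟨ %-cong-* m (squarings-%-pow m t a) (squarings-%-pow m t a) ⟩
  (a ^ (2 ^ t) * a ^ (2 ^ t)) % m ≡⟨ cong (_% m) (sym (^-distribˡ-+-* a (2 ^ t) (2 ^ t))) ⟩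
  (a ^ (2 ^ t + 2 ^ t)) % m       ≡⟨ cong (λ z → (a ^ (2 ^ t + z)) % m) (sym (+-identityʳ (2 ^ t))) ⟩
  (a ^ (2 ^ suc t)) % m           ∎
  where
  open ≡-Reasoning
  b = squarings m t a

periodic : ∀ m .{{_ : NonZero m}} a L → a % m ≡ (a ^ (2 ^ L)) % m →
           ∀ j → a % m ≡ (a ^ (2 ^ (j * L))) % m
periodic m a L a≡a^2^L zero    = cong (_% m) (sym (*-identityʳ a))
periodic m a L a≡a^2^L (suc j) = begin
  a % m                                 ≡⟨ periodic m a L a≡a^2^L j ⟩
  (a ^ (2 ^ (j * L))) % m               ≡⟨ %-cong-^ m a≡a^2^L (2 ^ (j * L)) ⟩
  ((a ^ (2 ^ L)) ^ (2 ^ (j * L))) % m   ≡⟨ cong (_% m) (^-*-assoc a (2 ^ L) (2 ^ (j * L))) ⟩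
  (a ^ (2 ^ L * 2 ^ (j * L))) % m       ≡⟨ cong (λ z → (a ^ z) % m) (sym (^-distribˡ-+-* 2 L (j * L))) ⟩
  (a ^ (2 ^ (L + j * L))) % m           ∎
  where open ≡-Reasoning

cycle-squarings : ∀ {m} .{{_ : NonZero m}} {n} {x : Fin (suc n) → Fin m} → IsCycle m n x →
                  ∀ t (i : Fin (suc n)) → toℕ i ≡ t → toℕ (x i) ≡ squarings m t (toℕ (x fzero))
cycle-squarings cycle zero    fzero    _       = refl
cycle-squarings {m} {x = x} cycle (suc t) (fsuc j) i≡1+t = begin
  toℕ (x (fsuc j))                                   ≡⟨ sym (IsCycle.step cycle j) ⟩
  square m (toℕ (x (inject₁ j)))                     ≡⟨ cong (square m) (cycle-squarings cycle t (inject₁ j) j≡t) ⟩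
  square m (squarings m t (toℕ (x fzero)))           ∎
  where
  open ≡-Reasoning
  j≡t : toℕ (inject₁ j) ≡ t
  j≡t = trans (toℕ-inject₁ j) (suc-injective i≡1+t)

-- If every residue a with a ≡ a^(2^L) for some L ≥ 1
-- satisfies a^(2^N) ≡ a, then every cycle has length at most N: a longer
-- cycle would return to its first element after N squarings.
cycle-length-bound : ∀ m .{{_ : NonZero m}} N → 0 < N →
  (∀ a L → 0 < L → a < m → a % m ≡ (a ^ (2 ^ L)) % m → (a ^ (2 ^ N)) % m ≡ a) →
  ∀ n (x : Fin (suc n) → Fin m) → IsCycle m n x → suc n ≤ N
cycle-length-bound m N 0<N fixed n x cycle with suc n ≤? N
... | yes short = short
... | no  long  = ⊥-elim (<⇒≢ 0<N (trans (sym (cong toℕ (IsCycle.distinct cycle (toℕ-injective returns))))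
                                            (toℕ-fromℕ< N<1+n)))
  where
  open ≡-Reasoning
  a = toℕ (x fzero)
  N<1+n : N < suc n
  N<1+n = ≰⇒> long
  full-turn : squarings m (suc n) a ≡ a
  full-turn = trans (cong (square m) (sym (cycle-squarings cycle n (fromℕ n) (toℕ-fromℕ n))))
                    (IsCycle.wrap cycle)
  a-periodic : a % m ≡ (a ^ (2 ^ suc n)) % m
  a-periodic = trans (cong (_% m) (sym full-turn)) (squarings-%-pow m (suc n) a)
  returns : toℕ (x (fromℕ< N<1+n)) ≡ a
  returns = begin
    toℕ (x (fromℕ< N<1+n))    ≡⟨ cycle-squarings cycle N (fromℕ< N<1+n) (toℕ-fromℕ< N<1+n) ⟩
    squarings m N a           ≡⟨ sym (m<n⇒m%n≡m (squarings<m N)) ⟩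
    squarings m N a % m       ≡⟨ squarings-%-pow m N a ⟩
    (a ^ (2 ^ N)) % m         ≡⟨ fixed a (suc n) z<s (toℕ<n (x fzero)) a-periodic ⟩
    a                         ∎
    where
    squarings<m : ∀ t → squarings m t a < m
    squarings<m zero    = toℕ<n (x fzero)
    squarings<m (suc t) = m%n<n _ m

orbit-cycle : ∀ m .{{_ : NonZero m}} n (v : ℕ → ℕ) → (∀ j → v j < m) →
  (∀ j → square m (v j) ≡ v (suc j)) → v (suc n) ≡ v 0 →
  (∀ i j → i < suc n → j < suc n → v i ≡ v j → i ≡ j) →
  ∃ λ (x : Fin (suc n) → Fin m) → IsCycle m n x
orbit-cycle m n v v<m squares returns distinct = x , record
  { distinct = λ {i} {j} xi≡xj → toℕ-injective (distinct (toℕ i) (toℕ j) (toℕ<n i) (toℕ<n j)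
                                   (trans (sym (toℕ-x i)) (trans (cong toℕ xi≡xj) (toℕ-x j))))
  ; step     = λ i → begin
      square m (toℕ (x (inject₁ i)))  ≡⟨ cong (square m) (trans (toℕ-x (inject₁ i)) (cong v (toℕ-inject₁ i))) ⟩
      square m (v (toℕ i))            ≡⟨ squares (toℕ i) ⟩
      v (suc (toℕ i))                 ≡⟨ sym (toℕ-x (fsuc i)) ⟩
      toℕ (x (fsuc i))                ∎
  ; wrap     = begin
      square m (toℕ (x (fromℕ n)))    ≡⟨ cong (square m) (trans (toℕ-x (fromℕ n)) (cong v (toℕ-fromℕ n))) ⟩
      square m (v n)                  ≡⟨ squares n ⟩
      v (suc n)                       ≡⟨ returns ⟩
      v 0                             ≡⟨ sym (toℕ-x fzero) ⟩
      toℕ (x fzero)                   ∎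
  }
  where
  open ≡-Reasoning
  x : Fin (suc n) → Fin m
  x i = fromℕ< (v<m (toℕ i))
  toℕ-x : ∀ i → toℕ (x i) ≡ v (toℕ i)
  toℕ-x i = toℕ-fromℕ< (v<m (toℕ i))

instance
  p*p-nonZero : ∀ {p} .{{_ : NonZero p}} → NonZero (p * p)
  p*p-nonZero {p} = m*n≢0 p p

1+p*r<p*p : ∀ p {r} → 1 < p → r < p → 1 + p * r < p * p
1+p*r<p*p p@(suc p′) {r} 1<p r<p = begin-strict
  1 + p * r       ≤⟨ +-monoʳ-≤ 1 (*-monoʳ-≤ p (≤-pred r<p)) ⟩
  1 + p * p′      <⟨ +-monoˡ-< (p * p′) 1<p ⟩
  p + p * p′      ≡⟨ sym (*-suc p p′) ⟩
  p * p           ∎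
  where open ≤-Reasoning

1+p*w-%-p² : ∀ p .{{_ : NonZero p}} → 1 < p → ∀ w → (1 + p * w) % (p * p) ≡ 1 + p * (w % p)
1+p*w-%-p² p 1<p w = begin
  (1 + p * w) % (p * p)                           ≡⟨ cong (λ z → (1 + p * z) % (p * p)) (m≡m%n+[m/n]*n w p) ⟩
  (1 + p * (w % p + (w / p) * p)) % (p * p)       ≡⟨ cong (_% (p * p)) (regroup p (w % p) (w / p)) ⟩
  (1 + p * (w % p) + (w / p) * (p * p)) % (p * p) ≡⟨ [m+kn]%n≡m%n (1 + p * (w % p)) (w / p) (p * p) ⟩
  (1 + p * (w % p)) % (p * p)                     ≡⟨ m<n⇒m%n≡m (1+p*r<p*p p 1<p (m%n<n w p)) ⟩
  1 + p * (w % p)                                 ∎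
  where
  open ≡-Reasoning
  regroup : ∀ p r t → 1 + p * (r + t * p) ≡ 1 + p * r + t * (p * p)
  regroup = solve-∀

-- If 2 has order exactly n+1 modulo p, i.e. 2^(n+1) ≡ 1 and 2^0, ..., 2^n are
-- distinct modulo p, then the residues 1 + p·2^j (j ≤ n) form a cycle of
-- length n+1 modulo p²: squaring turns 1 + p·w into 1 + p·2w modulo p².
doubling-cycle : ∀ p .{{_ : NonZero p}} n → 2 ^ suc n % p ≡ 1 →
  (∀ i j → i < suc n → j < suc n → 2 ^ i % p ≡ 2 ^ j % p → i ≡ j) →
  ∃ λ (x : Fin (suc n) → Fin (p * p)) → IsCycle (p * p) n x
doubling-cycle (suc zero) n order _ = ⊥-elim (0≢1+n (trans (sym (n%1≡0 (2 ^ suc n))) order))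
doubling-cycle p@(suc (suc _)) n order distinct =
  orbit-cycle m n v (λ j → m%n<n (1 + p * 2 ^ j) m) squares returns injective
  where
  open ≡-Reasoning
  m = p * p
  v : ℕ → ℕ
  v j = (1 + p * 2 ^ j) % m
  v≡1+p*r : ∀ j → v j ≡ 1 + p * (2 ^ j % p)
  v≡1+p*r j = 1+p*w-%-p² p (s<s z<s) (2 ^ j)

  squares : ∀ j → square m (v j) ≡ v (suc j)
  squares j = begin
    (v j * v j) % m                          ≡⟨ %-cong-* m {v j} {1 + p * w} {v j} {1 + p * w} (m%n%n≡m%n (1 + p * w) m) (m%n%n≡m%n (1 + p * w) m) ⟩
    ((1 + p * w) * (1 + p * w)) % m          ≡⟨ cong (_% m) (square-expand p w) ⟩
    (1 + p * (2 * w) + (w * w) * m) % m      ≡⟨ [m+kn]%n≡m%n (1 + p * (2 * w)) (w * w) m ⟩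
    v (suc j)                                ∎
    where
    w = 2 ^ j
    square-expand : ∀ p w → (1 + p * w) * (1 + p * w) ≡ 1 + p * (2 * w) + (w * w) * (p * p)
    square-expand = solve-∀

  returns : v (suc n) ≡ v 0
  returns = begin
    v (suc n)               ≡⟨ v≡1+p*r (suc n) ⟩
    1 + p * (2 ^ suc n % p) ≡⟨ cong (λ r → 1 + p * r) (trans order (sym (m<n⇒m%n≡m (s<s z<s)))) ⟩
    1 + p * (1 % p)         ≡⟨ sym (v≡1+p*r 0) ⟩
    v 0                     ∎

  injective : ∀ i j → i < suc n → j < suc n → v i ≡ v j → i ≡ j
  injective i j i<1+n j<1+n vi≡vj = distinct i j i<1+n j<1+n
    (*-cancelˡ-≡ (2 ^ i % p) (2 ^ j % p) p (suc-injective (trans (sym (v≡1+p*r i)) (trans vi≡vj (v≡1+p*r j)))))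

2^[E+E]≡p*pred[q]+1 : ∀ E → 2 ^ (E + E) ≡ suc (2 ^ E) * pred (2 ^ E) + 1
2^[E+E]≡p*pred[q]+1 E = begin
  2 ^ (E + E)                   ≡⟨ ^-distribˡ-+-* 2 E E ⟩
  q * q                         ≡⟨ cong (λ z → z * z) (sym (suc-pred q)) ⟩
  suc q′ * suc q′               ≡⟨ square-suc q′ ⟩
  suc (suc q′) * q′ + 1         ≡⟨ cong (λ z → suc z * q′ + 1) (suc-pred q) ⟩
  suc q * q′ + 1                ∎
  where
  open ≡-Reasoning
  q = 2 ^ E
  instance _ = m^n≢0 2 E
  q′ = pred q
  square-suc : ∀ r → suc r * suc r ≡ suc (suc r) * r + 1
  square-suc = solve-∀

2^[E+E]%p≡1 : ∀ E → 2 ^ (E + E) % suc (2 ^ E) ≡ 1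
2^[E+E]%p≡1 E = begin
  2 ^ (E + E) % p        ≡⟨ cong (_% p) (trans (2^[E+E]≡p*pred[q]+1 E) (+-comm (p * pred q) 1)) ⟩
  (1 + p * pred q) % p   ≡⟨ cong (λ z → (1 + z) % p) (*-comm p (pred q)) ⟩
  (1 + pred q * p) % p   ≡⟨ [m+kn]%n≡m%n 1 (pred q) p ⟩
  1 % p                  ≡⟨ m<n⇒m%n≡m (s<s (m^n>0 2 E)) ⟩
  1                      ∎
  where
  open ≡-Reasoning
  q = 2 ^ E
  p = suc q

split-<-+ : ∀ E a → a < E + E → a < E ⊎ ∃ λ c → c < E × a ≡ E + c
split-<-+ E a a<E+E with a <? E
... | yes a<E = inj₁ a<E
... | no  a≮E = inj₂ (a ∸ E , +-cancelˡ-< E (a ∸ E) E (subst (_< E + E) (sym a≡E+c) a<E+E) , sym a≡E+c)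
  where
  a≡E+c : E + (a ∸ E) ≡ a
  a≡E+c = m+[n∸m]≡n (≮⇒≥ a≮E)

2^-injective : ∀ {a b} → 2 ^ a ≡ 2 ^ b → a ≡ b
2^-injective {a} {b} 2^a≡2^b with <-cmp a b
... | tri< a<b _ _ = ⊥-elim (<⇒≢ (^-monoʳ-< 2 (s<s z<s) a<b) 2^a≡2^b)
... | tri≈ _ a≡b _ = a≡b
... | tri> _ _ b<a = ⊥-elim (<⇒≢ (^-monoʳ-< 2 (s<s z<s) b<a) (sym 2^a≡2^b))

-- Modulo p = 2^E + 1 with E ≥ 1, the powers 2^j for j < 2E are distinct:
-- for j < E they are the numbers 2^j themselves, and 2^(E+c) ≡ p - 2^c.
module PowersOfTwo (E′ : ℕ) where
  E = suc E′
  q = 2 ^ E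
  p = suc q

  2^<p : ∀ {a} → a < E → 2 ^ a < p
  2^<p a<E = ≤-trans (^-monoʳ-< 2 (s<s z<s) a<E) (n≤1+n q)

  2^-%-low : ∀ a → a < E → 2 ^ a % p ≡ 2 ^ a
  2^-%-low a a<E = m<n⇒m%n≡m (2^<p a<E)

  2^-%-high : ∀ c → c < E → 2 ^ (E + c) % p + 2 ^ c ≡ p
  2^-%-high c c<E = begin
    2 ^ (E + c) % p + w           ≡⟨ cong (λ z → z % p + w) (2^[E+c]≡d+[w-1]p) ⟩
    (d + w′ * p) % p + w          ≡⟨ cong (_+ w) ([m+kn]%n≡m%n d w′ p) ⟩
    d % p + w                     ≡⟨ cong (_+ w) (m<n⇒m%n≡m (s≤s (m∸n≤m q w′))) ⟩
    d + w                         ≡⟨ cong (d +_) (sym (suc-pred w)) ⟩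
    d + suc w′                    ≡⟨ +-suc d w′ ⟩
    suc (d + w′)                  ≡⟨ cong suc (m∸n+n≡m w′≤q) ⟩
    p                             ∎
    where
    open ≡-Reasoning
    w = 2 ^ c
    instance _ = m^n≢0 2 c
    w′ = pred w
    w′≤q : w′ ≤ q
    w′≤q = ≤-trans pred[n]≤n (≤-pred (2^<p c<E))
    d = q ∸ w′
    2^[E+c]≡d+[w-1]p : 2 ^ (E + c) ≡ d + w′ * p
    2^[E+c]≡d+[w-1]p = begin
      2 ^ (E + c)              ≡⟨ ^-distribˡ-+-* 2 E c ⟩
      q * w                    ≡⟨ cong (q *_) (sym (suc-pred w)) ⟩
      q * suc w′               ≡⟨ cong (_* suc w′) (sym (m∸n+n≡m w′≤q)) ⟩
      (d + w′) * suc w′        ≡⟨ expand d w′ ⟩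
      d + w′ * suc (d + w′)    ≡⟨ cong (λ z → d + w′ * suc z) (m∸n+n≡m w′≤q) ⟩
      d + w′ * p               ∎
      where
      expand : ∀ d w′ → (d + w′) * suc w′ ≡ d + w′ * suc (d + w′)
      expand = solve-∀

  -- Two powers 2^a, 2^c with a, c < E sum to at most 2^E < p.
  2^+2^≢p : ∀ a c → a < E → c < E → 2 ^ a + 2 ^ c ≢ p
  2^+2^≢p a c a<E c<E sum≡p = 1+n≰n (subst (_≤ q) sum≡p (begin
    2 ^ a + 2 ^ c       ≤⟨ +-mono-≤ (^-monoʳ-≤ 2 (≤-pred a<E)) (^-monoʳ-≤ 2 (≤-pred c<E)) ⟩
    2 ^ E′ + 2 ^ E′     ≡⟨ cong (2 ^ E′ +_) (sym (+-identityʳ (2 ^ E′))) ⟩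
    q                   ∎))
    where open ≤-Reasoning

  2^-%-injective : ∀ a b → a < E + E → b < E + E → 2 ^ a % p ≡ 2 ^ b % p → a ≡ b
  2^-%-injective a b a<2E b<2E ra≡rb with split-<-+ E a a<2E | split-<-+ E b b<2E
  ... | inj₁ a<E | inj₁ b<E =
    2^-injective (trans (sym (2^-%-low a a<E)) (trans ra≡rb (2^-%-low b b<E)))
  ... | inj₂ (c , c<E , refl) | inj₂ (c′ , c′<E , refl) =
    cong (E +_) (2^-injective (+-cancelˡ-≡ (2 ^ (E + c) % p) _ _
      (trans (2^-%-high c c<E) (trans (sym (2^-%-high c′ c′<E)) (cong (_+ 2 ^ c′) (sym ra≡rb))))))
  ... | inj₁ a<E | inj₂ (c , c<E , refl) =
    ⊥-elim (2^+2^≢p a c a<E c<E (trans (cong (_+ 2 ^ c) (trans (sym (2^-%-low a a<E)) ra≡rb)) (2^-%-high c c<E)))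
  ... | inj₂ (c , c<E , refl) | inj₁ b<E =
    ⊥-elim (2^+2^≢p b c b<E c<E (trans (cong (_+ 2 ^ c) (trans (sym (2^-%-low b b<E)) (sym ra≡rb))) (2^-%-high c c<E)))

a*a∣a^N : ∀ a N → 2 ≤ N → a * a ∣ a ^ N
a*a∣a^N a (suc zero) (s≤s ())
a*a∣a^N a (suc (suc N)) _ = divides (a ^ N) (begin
  a * (a * a ^ N)   ≡⟨ sym (*-assoc a a (a ^ N)) ⟩
  a * a * a ^ N     ≡⟨ *-comm (a * a) (a ^ N) ⟩
  a ^ N * (a * a)   ∎)
  where open ≡-Reasoning

0^n≡0 : ∀ n → 0 < n → 0 ^ n ≡ 0
0^n≡0 (suc n) _ = refl

module FermatPrime (E : ℕ) (prime-p : Prime (suc (2 ^ E))) where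
  q = 2 ^ E
  p = suc q
  m = p * p

  1<m : 1 < m
  1<m = ≤-trans (prime⇒1< prime-p) (m≤m*n p p)

  -- A periodic point divisible by p is 0, as p² then divides a^(2^L).
  p∣periodic⇒0 : ∀ a L → 0 < L → a < m → a % m ≡ (a ^ (2 ^ L)) % m → p ∣ a → a ≡ 0
  p∣periodic⇒0 a (suc L) _ a<m periodic-a p∣a = begin
    a                       ≡⟨ sym (m<n⇒m%n≡m a<m) ⟩
    a % m                   ≡⟨ periodic-a ⟩
    (a ^ (2 ^ suc L)) % m   ≡⟨ n∣m⇒m%n≡0 _ m (∣-trans (*-pres-∣ p∣a p∣a) (a*a∣a^N a (2 ^ suc L) 2≤2^[1+L])) ⟩
    0                       ∎
    where
    open ≡-Reasoning
    2≤2^[1+L] : 2 ≤ 2 ^ suc L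
    2≤2^[1+L] = *-monoʳ-≤ 2 (m^n>0 2 L)

  -- A periodic point prime to p satisfies a^p ≡ 1 (mod p²): a ≡ a^(2^(EL))
  -- and 2^(EL) is a multiple of p - 1 = 2^E, so a^p is a power of a^((p-1)p).
  periodic-unit⇒a^p≡1 : ∀ a L → 0 < L → a % m ≡ (a ^ (2 ^ L)) % m → ¬ (p ∣ a) → (a ^ p) % m ≡ 1
  periodic-unit⇒a^p≡1 a (suc L) _ periodic-a p∤a = begin
    (a ^ p) % m                            ≡⟨ %-cong-^ m {a} {a ^ (2 ^ (E * suc L))} (periodic m a (suc L) periodic-a E) p ⟩
    ((a ^ (2 ^ (E * suc L))) ^ p) % m      ≡⟨ cong (_% m) (^-*-assoc a (2 ^ (E * suc L)) p) ⟩
    (a ^ (2 ^ (E * suc L) * p)) % m        ≡⟨ cong (λ z → (a ^ z) % m) exponent ⟩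
    (a ^ (q * p * r)) % m                  ≡⟨ cong (_% m) (sym (^-*-assoc a (q * p) r)) ⟩
    ((a ^ (q * p)) ^ r) % m                ≡⟨ %-^-one m 1<m (fermat-lift q prime-p a p∤a) r ⟩
    1                                      ∎
    where
    open ≡-Reasoning
    r = 2 ^ (E * L)
    exponent : 2 ^ (E * suc L) * p ≡ q * p * r
    exponent = begin
      2 ^ (E * suc L) * p      ≡⟨ cong (λ z → 2 ^ z * p) (*-suc E L) ⟩
      2 ^ (E + E * L) * p      ≡⟨ cong (_* p) (^-distribˡ-+-* 2 E (E * L)) ⟩
      q * r * p                ≡⟨ xy∙z≈xz∙y q r p ⟩
      q * p * r                ∎

  -- Every periodic point of squaring modulo p² is fixed by 2E squarings,
  -- because 2^(2E) = p·(p - 2) + 1.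
  periodic⇒fixed : ∀ a L → 0 < L → a < m → a % m ≡ (a ^ (2 ^ L)) % m → (a ^ (2 ^ (E + E))) % m ≡ a
  periodic⇒fixed a L 0<L a<m periodic-a with p ∣? a
  ... | yes p∣a = subst (λ a → (a ^ (2 ^ (E + E))) % m ≡ a) (sym (p∣periodic⇒0 a L 0<L a<m periodic-a p∣a))
                        (cong (_% m) (0^n≡0 (2 ^ (E + E)) (m^n>0 2 (E + E))))
  ... | no  p∤a = begin
    (a ^ (2 ^ (E + E))) % m        ≡⟨ cong (λ z → (a ^ z) % m) (2^[E+E]≡p*pred[q]+1 E) ⟩
    (a ^ (p * q′ + 1)) % m         ≡⟨ cong (_% m) (^-distribˡ-+-* a (p * q′) 1) ⟩
    (a ^ (p * q′) * a ^ 1) % m     ≡⟨ cong (λ z → (z * a ^ 1) % m) (sym (^-*-assoc a p q′)) ⟩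
    ((a ^ p) ^ q′ * a ^ 1) % m     ≡⟨ %-cong-* m {(a ^ p) ^ q′} {1} {a ^ 1} {a ^ 1} a^pq′≡1 refl ⟩
    (1 * a ^ 1) % m                ≡⟨ cong (_% m) (trans (*-identityˡ (a ^ 1)) (*-identityʳ a)) ⟩
    a % m                          ≡⟨ m<n⇒m%n≡m a<m ⟩
    a                              ∎
    where
    open ≡-Reasoning
    q′ = pred q
    a^pq′≡1 : ((a ^ p) ^ q′) % m ≡ 1 % m
    a^pq′≡1 = trans (%-^-one m 1<m (periodic-unit⇒a^p≡1 a L 0<L periodic-a p∤a) q′)
                    (sym (m<n⇒m%n≡m 1<m))

fermat-prime-max-cycle : ∀ E → 0 < E → Prime (suc (2 ^ E)) →
  IsMaxCycleLength (suc (2 ^ E) * suc (2 ^ E)) (E + E)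
fermat-prime-max-cycle (suc E′) _ prime-p =
  (E′ + E , refl , doubling-cycle p (E′ + E) (2^[E+E]%p≡1 E) (PowersOfTwo.2^-%-injective E′)) ,
  cycle-length-bound (p * p) (E + E) z<s (FermatPrime.periodic⇒fixed E prime-p)
  where
  E = suc E′
  p = suc (2 ^ E)

2^[1+k]≡2^k+2^k : ∀ k → 2 ^ (k + 1) ≡ 2 ^ k + 2 ^ k
2^[1+k]≡2^k+2^k k = trans (cong (2 ^_) (+-comm k 1)) (cong (2 ^ k +_) (+-identityʳ (2 ^ k)))

n<2^n : ∀ n → n < 2 ^ n
n<2^n zero    = z<s
n<2^n (suc n) = +-mono-≤ (m^n>0 2 n) (≤-trans (n<2^n n) (≤-reflexive (sym (+-identityʳ (2 ^ n)))))

p-1≡2^[2^k∸k∸1]*2^[k+1] : ∀ k → suc (2 ^ (2 ^ k)) ∸ 1 ≡ 2 ^ (2 ^ k ∸ k ∸ 1) * 2 ^ (k + 1)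
p-1≡2^[2^k∸k∸1]*2^[k+1] k = begin
  2 ^ (2 ^ k)                            ≡⟨ cong (2 ^_) (sym (m∸n+n≡m k+1≤2^k)) ⟩
  2 ^ (2 ^ k ∸ (k + 1) + (k + 1))        ≡⟨ ^-distribˡ-+-* 2 (2 ^ k ∸ (k + 1)) (k + 1) ⟩
  2 ^ (2 ^ k ∸ (k + 1)) * 2 ^ (k + 1)    ≡⟨ cong (λ z → 2 ^ z * 2 ^ (k + 1)) (sym (∸-+-assoc (2 ^ k) k 1)) ⟩
  2 ^ (2 ^ k ∸ k ∸ 1) * 2 ^ (k + 1)      ∎
  where
  open ≡-Reasoning
  k+1≤2^k : k + 1 ≤ 2 ^ k
  k+1≤2^k = subst (_≤ 2 ^ k) (+-comm 1 k) (n<2^n k)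

proposition2 : ∀ (k : ℕ) → Prime (suc (2 ^ (2 ^ k))) →
    IsMaxCycleLength (suc (2 ^ (2 ^ k)) * suc (2 ^ (2 ^ k))) (2 ^ (k + 1))
    × (suc (2 ^ (2 ^ k)) ∸ 1 ≡ 2 ^ (2 ^ k ∸ k ∸ 1) * 2 ^ (k + 1))
proposition2 k prime-p = max-cycle , p-1≡2^[2^k∸k∸1]*2^[k+1] k
  where
  p = suc (2 ^ (2 ^ k))
  max-cycle : IsMaxCycleLength (p * p) (2 ^ (k + 1))
  max-cycle = subst (IsMaxCycleLength (p * p)) (sym (2^[1+k]≡2^k+2^k k))
                    (fermat-prime-max-cycle (2 ^ k) (m^n>0 2 k) prime-p)
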